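{- Suppose the derangement $\sigma\in S_n$ is a product of two disjoint cycles $\sigma_1,\sigma_2$ of lengths $n_1,n_2$ (so $n_1+n_2=n$), and let $M=I+P_\sigma$. (a) If $n_1>n_2\ge 2$, then the stabilizer of $M$ in $G$ has order $8n_1n_2$, and the $G$-orbit of $M$ has $(n!)^2/(4n_1n_2)$ elements. (b) If $n>4$ and $n_1=n_2$, then the stabilizer of $M$ in $G$ has order $4n^2$, and the $G$-orbit of $M$ has $((n-1)!)^2/2$ elements.
   Context: $P_\sigma$ is the permutation matrix of $\sigma\in S_n$ with $P_\sigma P_\tau=P_{\sigma\tau}$, and $I$ is the $n\times n$ identity matrix. A derangement is a permutation with no fixed points. $G$ is the group of order $2(n!)^2$ acting on $n\times n$ matrices by the maps $M\mapsto P_\alpha M P_\beta^{ -1}$ and $M\mapsto P_\alpha M^T P_\beta^{ -1}$ for $\alpha,\beta\in S_n$ (generated by row permutations, column permutations and transpose). -}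

module Defs where

open import Level using (0ℓ)
open import Data.Nat using (ℕ; zero; suc; _+_; _<_)
open import Data.Bool using (Bool; true; false; if_then_else_)
open import Data.Fin using (Fin)
open import Data.Fin.Properties using (_≟_)
open import Data.Fin.Permutation using (Permutation′; _⟨$⟩ʳ_; _⟨$⟩ˡ_)
open import Data.Product using (Σ; _×_; _,_; proj₁; proj₂; ∃)
open import Relation.Nullary using (¬_)
open import Relation.Nullary.Decidable using (⌊_⌋)
open import Relation.Binary.PropositionalEquality using (_≡_; _≢_; refl; sym; trans; cong)
open import Relation.Binary.Bundles using (Setoid)
import Relation.Binary.PropositionalEquality as PE
open import Function.Bundles using (Inverse)

Matrix : ℕ → Set
Matrix n = Fin n → Fin n → ℕ

δ : ∀ {n} → Fin n → Fin n → ℕ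
δ i j = if ⌊ i ≟ j ⌋ then 1 else 0

I : ∀ {n} → Matrix n
I i j = δ i j

-- Permutation matrix, with the convention P_σ e_j = e_{σ(j)},
-- i.e. (P_σ)_{ij} = [i = σ(j)], so that P_σ P_τ = P_{στ}.
P : ∀ {n} → Permutation′ n → Matrix n
P σ i j = δ i (σ ⟨$⟩ʳ j)

_⊕_ : ∀ {n} → Matrix n → Matrix n → Matrix n
(A ⊕ B) i j = A i j + B i j

Transpose : ∀ {n} → Matrix n → Matrix n
Transpose A i j = A j i

_≈ₘ_ : ∀ {n} → Matrix n → Matrix n → Set
A ≈ₘ B = ∀ i j → A i j ≡ B i j

Derangement : ∀ {n} → Permutation′ n → Set
Derangement σ = ∀ x → σ ⟨$⟩ʳ x ≢ x

iter : ∀ {n} → Permutation′ n → ℕ → Fin n → Fin n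
iter σ zero    x = x
iter σ (suc k) x = σ ⟨$⟩ʳ iter σ k x

TwoCycleProduct : ∀ {n} → Permutation′ n → ℕ → ℕ → Set
TwoCycleProduct {n} σ n₁ n₂ =
  Σ (Fin n) λ x₁ → Σ (Fin n) λ x₂ →
    iter σ n₁ x₁ ≡ x₁ ×
    iter σ n₂ x₂ ≡ x₂ ×
    (∀ k l → k < n₁ → l < n₁ → iter σ k x₁ ≡ iter σ l x₁ → k ≡ l) ×
    (∀ k l → k < n₂ → l < n₂ → iter σ k x₂ ≡ iter σ l x₂ → k ≡ l) ×
    (∀ k l → k < n₁ → l < n₂ → iter σ k x₁ ≢ iter σ l x₂) ×
    (∀ y → (Σ ℕ λ k → k < n₁ × iter σ k x₁ ≡ y) ⊎′ (Σ ℕ λ l → l < n₂ × iter σ l x₂ ≡ y))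
  where open import Data.Sum using () renaming (_⊎_ to _⊎′_)

-- The group G: elements (t, α, β); t = false acts by M ↦ P_α M P_β⁻¹,
-- t = true acts by M ↦ P_α Mᵀ P_β⁻¹.
G : ℕ → Set
G n = Bool × Permutation′ n × Permutation′ n

_≈G_ : ∀ {n} → G n → G n → Set
(t , α , β) ≈G (t′ , α′ , β′) =
  t ≡ t′ × (∀ x → α ⟨$⟩ʳ x ≡ α′ ⟨$⟩ʳ x) × (∀ x → β ⟨$⟩ʳ x ≡ β′ ⟨$⟩ʳ x)

-- (P_α M P_β⁻¹)_{ij} = M_{α⁻¹(i), β⁻¹(j)}
act : ∀ {n} → G n → Matrix n → Matrix n
act (false , α , β) M i j = M (α ⟨$⟩ˡ i) (β ⟨$⟩ˡ j)
act (true  , α , β) M i j = Transpose M (α ⟨$⟩ˡ i) (β ⟨$⟩ˡ j)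

Stabilizer : ∀ {n} → Matrix n → Setoid 0ℓ 0ℓ
Stabilizer {n} M = record
  { Carrier = Σ (G n) λ g → act g M ≈ₘ M
  ; _≈_ = λ a b → proj₁ a ≈G proj₁ b
  ; isEquivalence = record
    { refl = refl , (λ _ → refl) , (λ _ → refl)
    ; sym = λ (p , q , r) → sym p , (λ x → sym (q x)) , (λ x → sym (r x))
    ; trans = λ (p , q , r) (p′ , q′ , r′) →
        trans p p′ , (λ x → trans (q x) (q′ x)) , (λ x → trans (r x) (r′ x))
    }
  }

Orbit : ∀ {n} → Matrix n → Setoid 0ℓ 0ℓ
Orbit {n} M = record
  { Carrier = Σ (Matrix n) λ N → Σ (G n) λ g → act g M ≈ₘ N
  ; _≈_ = λ a b → proj₁ a ≈ₘ proj₁ b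
  ; isEquivalence = record
    { refl = λ _ _ → refl
    ; sym = λ p i j → sym (p i j)
    ; trans = λ p q i j → trans (p i j) (q i j)
    }
  }

HasSize : Setoid 0ℓ 0ℓ → ℕ → Set
HasSize S k = Inverse (PE.setoid (Fin k)) S

-- An element (false, α, β) of G fixes M = I + P σ iff every column j is mapped compatibly:
-- either β j = α j and α σ = σ α at j, or β j = σ⁻¹ α j and α σ = σ⁻¹ α at j.  The choice
-- propagates along each cycle, so α maps each cycle onto a cycle of the same length,
-- commuting with σ or reversing it there.  Such a pair is therefore determined by whether
-- it swaps the two cycles (possible only when n₁ = n₂), by the positions of the images of
-- the two starting points, and by one commute/reverse bit per cycle: n₁ · 2 · n₂ · 2 pairs,
-- doubled when swapping is allowed.  A permutation reversing σ turns Mᵀ into a relabelling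
-- of M, so the transposing elements double the count once more, and the orbit sizes follow
-- from the orbit–stabilizer theorem.

module Submission where

open import Defs
open import Level using (0ℓ)
open import Data.Bool using (Bool; true; false; not; _xor_; if_then_else_)
open import Data.Bool.Properties using (¬-not; not-involutive; not-distribʳ-xor; xor-comm; xor-identityʳ)
open import Data.Empty using (⊥-elim)
open import Data.Fin using (Fin; zero; suc; toℕ; fromℕ<; punchIn; punchOut)
open import Data.Fin.Properties
  using (_≟_; all?; any?; *↔×; 2↔Bool; toℕ<n; toℕ-fromℕ<; fromℕ<-toℕ; fromℕ<-cong;
         punchIn-injective; punchOut-injective; injective⇒≤)
open import Data.Fin.Permutation as Perm using (Permutation′; _⟨$⟩ʳ_; _⟨$⟩ˡ_; _∘ₚ_)
open import Data.Nat using (ℕ; zero; suc; _+_; _*_; _^_; _<_; _≤_; _∸_; _!; z<s)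
import Data.Nat.Properties as ℕ
open import Data.Nat.Properties
  using (+-comm; m∸n+n≡m; <-cmp; <-irrefl; <-≤-trans; <-trans; <⇒≤; m≤n⇒m<n∨m≡n;
         1+n≰n; 1+n≢0; >⇒≢; *-cancelˡ-≡; *-identityʳ)
open import Data.Nat.Tactic.RingSolver using (solve-∀)
open import Data.Product using (Σ; ∃; _×_; _,_; proj₁; proj₂)
open import Data.Product.Relation.Binary.Pointwise.NonDependent using (_×ₛ_; Pointwise-≡↔≡)
open import Data.Product.Function.NonDependent.Setoid using (_×-inverse_)
open import Data.Sum using (_⊎_; inj₁; inj₂; [_,_]′)
open import Function.Bundles using (Inverse; Injection)
open import Function.Definitions using (Congruent; Injective; StrictlyInverseˡ; StrictlyInverseʳ)
open import Function.Construct.Composition using () renaming (inverse to ↔ₛ-trans)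
open import Function.Construct.Symmetry using () renaming (inverse to ↔ₛ-sym)
open import Function.Construct.Identity using () renaming (inverse to ↔ₛ-refl)
import Function.Consequences.Setoid as FunctionConsequences
open import Function.Properties.Inverse using (↔⇒↣)
open import Relation.Binary.Bundles using (Setoid)
open import Relation.Binary.Definitions using (Decidable; tri<; tri≈; tri>)
open import Relation.Binary.PropositionalEquality as ≡ using (_≡_; _≢_; refl; sym; trans; cong; cong₂; subst)
open import Relation.Nullary using (Dec; yes; no; ¬_; does)
open import Relation.Unary using (Pred) renaming (Decidable to Decidableᵘ)

open Setoid using (Carrier)
open ≡.≡-Reasoning

-- Finite cardinalities of setoids

mkInverseₛ : {A B : Setoid 0ℓ 0ℓ} (to : Carrier A → Carrier B) (from : Carrier B → Carrier A) →
  Congruent (Setoid._≈_ A) (Setoid._≈_ B) to → Congruent (Setoid._≈_ B) (Setoid._≈_ A) from →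
  StrictlyInverseˡ (Setoid._≈_ B) to from → StrictlyInverseʳ (Setoid._≈_ A) to from →
  Inverse A B
mkInverseₛ {A} {B} to from to-cong from-cong to∘from from∘to = record
  { to = to ; from = from ; to-cong = to-cong ; from-cong = from-cong
  ; inverse = strictlyInverseˡ⇒inverseˡ to-cong to∘from , strictlyInverseʳ⇒inverseʳ from-cong from∘to }
  where open FunctionConsequences A B

HasSize-unique : ∀ {S a b} → HasSize S a → HasSize S b → a ≡ b
HasSize-unique e e′ = Perm.↔⇒≡ (↔ₛ-trans e (↔ₛ-sym e′))

HasSize-× : ∀ {A B a b} → HasSize A a → HasSize B b → HasSize (A ×ₛ B) (a * b)
HasSize-× e e′ = ↔ₛ-trans (↔ₛ-trans *↔× (↔ₛ-sym Pointwise-≡↔≡)) (e ×-inverse e′)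

HasSize-Fin : ∀ k → HasSize (≡.setoid (Fin k)) k
HasSize-Fin k = ↔ₛ-refl _

HasSize-Bool : HasSize (≡.setoid Bool) 2
HasSize-Bool = 2↔Bool

Permutation-setoid : ℕ → Setoid 0ℓ 0ℓ
Permutation-setoid n = record
  { Carrier = Permutation′ n
  ; _≈_ = Perm._≈_
  ; isEquivalence = record { refl = λ _ → refl ; sym = λ p x → sym (p x) ; trans = λ p q x → trans (p x) (q x) }
  }

module _ {n : ℕ} where

  remove-cong : ∀ {π ρ : Permutation′ (suc n)} → π Perm.≈ ρ → Perm.remove zero π Perm.≈ Perm.remove zero ρ
  remove-cong {π} {ρ} π≈ρ j = punchIn-injective (π ⟨$⟩ʳ zero) _ _ (begin
    punchIn (π ⟨$⟩ʳ zero) (Perm.remove zero π ⟨$⟩ʳ j) ≡⟨ sym (Perm.punchIn-permute π zero j) ⟩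
    π ⟨$⟩ʳ suc j                                      ≡⟨ π≈ρ (suc j) ⟩
    ρ ⟨$⟩ʳ suc j                                      ≡⟨ Perm.punchIn-permute ρ zero j ⟩
    punchIn (ρ ⟨$⟩ʳ zero) (Perm.remove zero ρ ⟨$⟩ʳ j) ≡⟨ cong (λ z → punchIn z _) (sym (π≈ρ zero)) ⟩
    punchIn (π ⟨$⟩ʳ zero) (Perm.remove zero ρ ⟨$⟩ʳ j) ∎)

  insert-cong : ∀ (i : Fin (suc n)) {π ρ : Permutation′ n} → π Perm.≈ ρ → Perm.insert zero i π Perm.≈ Perm.insert zero i ρ
  insert-cong i π≈ρ zero = refl
  insert-cong i {π} {ρ} π≈ρ (suc k) = begin
    Perm.insert zero i π ⟨$⟩ʳ suc k ≡⟨ Perm.insert-punchIn zero i π k ⟩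
    punchIn i (π ⟨$⟩ʳ k)            ≡⟨ cong (punchIn i) (π≈ρ k) ⟩
    punchIn i (ρ ⟨$⟩ʳ k)            ≡⟨ sym (Perm.insert-punchIn zero i ρ k) ⟩
    Perm.insert zero i ρ ⟨$⟩ʳ suc k ∎

  Fin×Permutation↔Permutation : Inverse (≡.setoid (Fin (suc n)) ×ₛ Permutation-setoid n) (Permutation-setoid (suc n))
  Fin×Permutation↔Permutation = mkInverseₛ
    (λ (i , π) → Perm.insert zero i π)
    (λ π → π ⟨$⟩ʳ zero , Perm.remove zero π)
    (λ { {i , _} (refl , π≈ρ) → insert-cong i π≈ρ })
    (λ {π} {ρ} π≈ρ → π≈ρ zero , remove-cong {π} {ρ} π≈ρ)
    (Perm.insert-remove zero)
    (λ (i , π) → refl , Perm.remove-insert zero i π)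

Permutation-size : ∀ n → HasSize (Permutation-setoid n) (n !)
Permutation-size zero = mkInverseₛ (λ _ → Perm.id) (λ _ → zero) (λ _ ()) (λ _ → refl) (λ _ ()) (λ { zero → refl })
Permutation-size (suc n) = ↔ₛ-trans (HasSize-× (HasSize-Fin (suc n)) (Permutation-size n)) Fin×Permutation↔Permutation

module _ {N : ℕ} {Q : Pred (Fin (suc N)) 0ℓ} where

  ∃-tail : ∃ Q → ¬ Q zero → ∃ (λ i → Q (suc i))
  ∃-tail (zero , q) ¬q = ⊥-elim (¬q q)
  ∃-tail (suc i , q) ¬q = i , q

first : ∀ {N} {Q : Pred (Fin N) 0ℓ} → Decidableᵘ Q → ∃ Q → Fin N
first {suc N} Q? ∃q with Q? zero
... | yes _ = zero
... | no ¬q = suc (first (λ i → Q? (suc i)) (∃-tail ∃q ¬q))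

first-satisfies : ∀ {N} {Q : Pred (Fin N) 0ℓ} (Q? : Decidableᵘ Q) (∃q : ∃ Q) → Q (first Q? ∃q)
first-satisfies {suc N} Q? ∃q with Q? zero
... | yes q = q
... | no ¬q = first-satisfies (λ i → Q? (suc i)) (∃-tail ∃q ¬q)

first-cong : ∀ {N} {Q R : Pred (Fin N) 0ℓ} (Q? : Decidableᵘ Q) (R? : Decidableᵘ R) (∃q : ∃ Q) (∃r : ∃ R) →
  (∀ i → Q i → R i) → (∀ i → R i → Q i) → first Q? ∃q ≡ first R? ∃r
first-cong {suc N} Q? R? ∃q ∃r Q⇒R R⇒Q with Q? zero | R? zero
... | yes _ | yes _ = refl
... | yes q | no ¬r = ⊥-elim (¬r (Q⇒R zero q))
... | no ¬q | yes r = ⊥-elim (¬q (R⇒Q zero r))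
... | no ¬q | no ¬r = cong suc (first-cong (λ i → Q? (suc i)) (λ i → R? (suc i)) _ _
                        (λ i → Q⇒R (suc i)) (λ i → R⇒Q (suc i)))

Subset-setoid : ∀ {N} → Pred (Fin N) 0ℓ → Setoid 0ℓ 0ℓ
Subset-setoid {N} Q = record
  { Carrier = Σ (Fin N) Q ; _≈_ = λ a b → proj₁ a ≡ proj₁ b
  ; isEquivalence = record { refl = refl ; sym = sym ; trans = trans } }

count : ∀ {N} {Q : Pred (Fin N) 0ℓ} → Decidableᵘ Q → ℕ
count {zero} Q? = 0
count {suc N} Q? with Q? zero
... | yes _ = suc (count (λ i → Q? (suc i)))
... | no _ = count (λ i → Q? (suc i))

Subset-size : ∀ {N} {Q : Pred (Fin N) 0ℓ} (Q? : Decidableᵘ Q) → HasSize (Subset-setoid Q) (count Q?)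
Subset-size {zero} Q? = mkInverseₛ (λ ()) (λ ()) (λ { {()} }) (λ { {() , _} }) (λ ()) (λ ())
Subset-size {suc N} {Q} Q? with Q? zero | Subset-size (λ i → Q? (suc i))
... | yes q | tail = mkInverseₛ to from (λ { refl → refl }) from-cong
      (λ { (zero , _) → refl ; (suc j , qj) → cong suc (strictlyInverseˡ (j , qj)) })
      (λ { zero → refl ; (suc i) → cong suc (strictlyInverseʳ i) })
  where
  open Inverse tail using (strictlyInverseˡ; strictlyInverseʳ)
  to : Fin (suc (count (λ i → Q? (suc i)))) → Σ (Fin (suc N)) Q
  to zero = zero , q
  to (suc i) = suc (proj₁ (Inverse.to tail i)) , proj₂ (Inverse.to tail i)
  from : Σ (Fin (suc N)) Q → Fin (suc (count (λ i → Q? (suc i))))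
  from (zero , _) = zero
  from (suc j , qj) = suc (Inverse.from tail (j , qj))
  from-cong : ∀ {x y : Σ (Fin (suc N)) Q} → proj₁ x ≡ proj₁ y → from x ≡ from y
  from-cong {zero , _} {zero , _} refl = refl
  from-cong {suc j , _} {suc .j , _} refl = cong suc (Inverse.from-cong tail refl)
... | no ¬q | tail = mkInverseₛ to from (λ { refl → refl }) from-cong
      (λ { (zero , q) → ⊥-elim (¬q q) ; (suc j , qj) → cong suc (strictlyInverseˡ (j , qj)) })
      strictlyInverseʳ
  where
  open Inverse tail using (strictlyInverseˡ; strictlyInverseʳ)
  to : Fin (count (λ i → Q? (suc i))) → Σ (Fin (suc N)) Q
  to i = suc (proj₁ (Inverse.to tail i)) , proj₂ (Inverse.to tail i)
  from : Σ (Fin (suc N)) Q → Fin (count (λ i → Q? (suc i)))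
  from (zero , q) = ⊥-elim (¬q q)
  from (suc j , qj) = Inverse.from tail (j , qj)
  from-cong : ∀ {x y : Σ (Fin (suc N)) Q} → proj₁ x ≡ proj₁ y → from x ≡ from y
  from-cong {zero , q} {zero , _} refl = ⊥-elim (¬q q)
  from-cong {suc j , _} {suc .j , _} refl = Inverse.from-cong tail refl

module _ {N : ℕ} {Y : Setoid 0ℓ 0ℓ} (_≟Y_ : Decidable (Setoid._≈_ Y))
         (c : Fin N → Carrier Y) (c-surjective : ∀ y → ∃ λ i → Setoid._≈_ Y (c i) y) where

  open Setoid Y using (_≈_)

  index : Carrier Y → Fin N
  index y = first (λ i → c i ≟Y y) (c-surjective y)

  c∘index : ∀ y → c (index y) ≈ y
  c∘index y = first-satisfies (λ i → c i ≟Y y) (c-surjective y)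

  index-cong : ∀ {y y′} → y ≈ y′ → index y ≡ index y′
  index-cong y≈y′ = first-cong _ _ _ _ (λ _ p → Setoid.trans Y p y≈y′) (λ _ p → Setoid.trans Y p (Setoid.sym Y y≈y′))

  IsCanonical : Pred (Fin N) 0ℓ
  IsCanonical i = index (c i) ≡ i

  canonical↔Y : Inverse (Subset-setoid IsCanonical) Y
  canonical↔Y = mkInverseₛ (λ (i , _) → c i) (λ y → index y , index-cong (c∘index y))
    (λ { refl → Setoid.refl Y }) index-cong c∘index proj₂

  image-size : ∃ (HasSize Y)
  image-size = _ , ↔ₛ-trans (Subset-size (λ i → index (c i) ≟ i)) canonical↔Y

Fibre : (X Y : Setoid 0ℓ 0ℓ) → (Carrier X → Carrier Y) → Carrier Y → Setoid 0ℓ 0ℓ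
Fibre X Y f y = record
  { Carrier = Σ (Carrier X) (λ x → Setoid._≈_ Y (f x) y)
  ; _≈_ = λ a b → Setoid._≈_ X (proj₁ a) (proj₁ b)
  ; isEquivalence = record { refl = Setoid.refl X ; sym = Setoid.sym X ; trans = Setoid.trans X } }

module _ {X Y : Setoid 0ℓ 0ℓ} {k s : ℕ} (eY : HasSize Y k)
         (f : Carrier X → Carrier Y) (f-cong : Congruent (Setoid._≈_ X) (Setoid._≈_ Y) f)
         (eF : ∀ y → HasSize (Fibre X Y f y) s) where

  private
    module X = Setoid X
    module Y = Setoid Y
    module eY = Inverse eY
    module eF y = Inverse (eF y)

    fibre-index-cong : ∀ {i i′} → i ≡ i′ → ∀ {x x′} (p : f x Y.≈ eY.to i) (p′ : f x′ Y.≈ eY.to i′) →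
                       x X.≈ x′ → eF.from _ (x , p) ≡ eF.from _ (x′ , p′)
    fibre-index-cong refl p p′ x≈x′ = eF.from-cong _ x≈x′

    image-index : ∀ i t → eY.from (f (proj₁ (eF.to (eY.to i) t))) ≡ i
    image-index i t = trans (eY.from-cong (proj₂ (eF.to (eY.to i) t))) (eY.strictlyInverseʳ i)

    X↔Fin×Fin : Inverse X (≡.setoid (Fin k) ×ₛ ≡.setoid (Fin s))
    X↔Fin×Fin = mkInverseₛ
      (λ x → eY.from (f x) , eF.from (eY.to (eY.from (f x))) (x , Y.sym (eY.strictlyInverseˡ (f x))))
      (λ (i , t) → proj₁ (eF.to (eY.to i) t))
      (λ x≈x′ → eY.from-cong (f-cong x≈x′) , fibre-index-cong (eY.from-cong (f-cong x≈x′)) _ _ x≈x′)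
      (λ { (refl , refl) → X.refl })
      (λ (i , t) → image-index i t ,
        trans (fibre-index-cong (image-index i t) _ _ X.refl) (eF.strictlyInverseʳ (eY.to i) t))
      (λ x → eF.strictlyInverseˡ (eY.to (eY.from (f x))) (x , Y.sym (eY.strictlyInverseˡ (f x))))

  fibres-size : HasSize X (k * s)
  fibres-size = ↔ₛ-trans (HasSize-× (HasSize-Fin k) (HasSize-Fin s)) (↔ₛ-sym X↔Fin×Fin)

module _ {X Y : Setoid 0ℓ 0ℓ} {N s : ℕ} (eX : HasSize X N) (_≟Y_ : Decidable (Setoid._≈_ Y))
         (f : Carrier X → Carrier Y) (f-cong : Congruent (Setoid._≈_ X) (Setoid._≈_ Y) f)
         (f-surjective : ∀ y → ∃ λ x → Setoid._≈_ Y (f x) y)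
         (eF : ∀ y → HasSize (Fibre X Y f y) s) where

  private
    module eX = Inverse eX

    c-surjective : ∀ y → ∃ λ i → Setoid._≈_ Y (f (eX.to i)) y
    c-surjective y = let (x , fx≈y) = f-surjective y in
      eX.from x , Setoid.trans Y (f-cong (eX.strictlyInverseˡ x)) fx≈y

  image-size-by-fibres : ∃ λ k → HasSize Y k × N ≡ k * s
  image-size-by-fibres = let (k , eY) = image-size _≟Y_ (λ i → f (eX.to i)) c-surjective in
    k , eY , HasSize-unique eX (fibres-size eY f f-cong eF)

-- Orbit–stabilizer for G

G-setoid : ℕ → Setoid 0ℓ 0ℓ
G-setoid n = record
  { Carrier = G n ; _≈_ = _≈G_
  ; isEquivalence = record
    { refl = refl , (λ _ → refl) , (λ _ → refl)
    ; sym = λ (p , q , r) → sym p , (λ x → sym (q x)) , (λ x → sym (r x))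
    ; trans = λ (p , q , r) (p′ , q′ , r′) →
        trans p p′ , (λ x → trans (q x) (q′ x)) , (λ x → trans (r x) (r′ x)) } }

G-size : ∀ n → HasSize (G-setoid n) (2 * (n ! * n !))
G-size n = ↔ₛ-trans (HasSize-× HasSize-Bool (HasSize-× (Permutation-size n) (Permutation-size n)))
  (mkInverseₛ (λ g → g) (λ g → g) (λ p → p) (λ p → p)
    (λ _ → refl , (λ _ → refl) , (λ _ → refl)) (λ _ → refl , (λ _ → refl) , (λ _ → refl)))

module _ {n : ℕ} where

  infixl 30 _·_
  infix 40 _⁻¹

  _·_ : G n → G n → G n
  (false , α , β) · (t , α′ , β′) = t , α′ ∘ₚ α , β′ ∘ₚ β
  (true , α , β) · (false , α′ , β′) = true , β′ ∘ₚ α , α′ ∘ₚ β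
  (true , α , β) · (true , α′ , β′) = false , β′ ∘ₚ α , α′ ∘ₚ β

  _⁻¹ : G n → G n
  (false , α , β) ⁻¹ = false , Perm.flip α , Perm.flip β
  (true , α , β) ⁻¹ = true , Perm.flip β , Perm.flip α

  ·-congˡ : ∀ g {h h′} → h ≈G h′ → g · h ≈G g · h′
  ·-congˡ (false , α , β) (refl , p , q) = refl , (λ x → cong (α ⟨$⟩ʳ_) (p x)) , (λ x → cong (β ⟨$⟩ʳ_) (q x))
  ·-congˡ (true , α , β) {false , _} (refl , p , q) = refl , (λ x → cong (α ⟨$⟩ʳ_) (q x)) , (λ x → cong (β ⟨$⟩ʳ_) (p x))
  ·-congˡ (true , α , β) {true , _} (refl , p , q) = refl , (λ x → cong (α ⟨$⟩ʳ_) (q x)) , (λ x → cong (β ⟨$⟩ʳ_) (p x))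

  ·-inverseʳ : ∀ g h → g · (g ⁻¹ · h) ≈G h
  ·-inverseʳ (false , α , β) h = refl , (λ _ → Perm.inverseʳ α) , (λ _ → Perm.inverseʳ β)
  ·-inverseʳ (true , α , β) (false , _) = refl , (λ _ → Perm.inverseʳ α) , (λ _ → Perm.inverseʳ β)
  ·-inverseʳ (true , α , β) (true , _) = refl , (λ _ → Perm.inverseʳ α) , (λ _ → Perm.inverseʳ β)

  ·-inverseˡ : ∀ g h → g ⁻¹ · (g · h) ≈G h
  ·-inverseˡ (false , α , β) h = refl , (λ _ → Perm.inverseˡ α) , (λ _ → Perm.inverseˡ β)
  ·-inverseˡ (true , α , β) (false , _) = refl , (λ _ → Perm.inverseˡ β) , (λ _ → Perm.inverseˡ α)
  ·-inverseˡ (true , α , β) (true , _) = refl , (λ _ → Perm.inverseˡ β) , (λ _ → Perm.inverseˡ α)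

  act-· : ∀ g h (A : Matrix n) → act (g · h) A ≈ₘ act g (act h A)
  act-· (false , _) (false , _) A i j = refl
  act-· (false , _) (true , _) A i j = refl
  act-· (true , _) (false , _) A i j = refl
  act-· (true , _) (true , _) A i j = refl

  act-⁻¹ : ∀ g (A : Matrix n) → act (g ⁻¹) (act g A) ≈ₘ A
  act-⁻¹ (false , α , β) A i j = cong₂ A (Perm.inverseˡ α) (Perm.inverseˡ β)
  act-⁻¹ (true , α , β) A i j = cong₂ A (Perm.inverseˡ β) (Perm.inverseˡ α)

  act-congʳ : ∀ g {A B : Matrix n} → A ≈ₘ B → act g A ≈ₘ act g B
  act-congʳ (false , _) A≈B i j = A≈B _ _
  act-congʳ (true , _) A≈B i j = A≈B _ _

  flip-cong : ∀ {π ρ : Permutation′ n} → π Perm.≈ ρ → ∀ y → π ⟨$⟩ˡ y ≡ ρ ⟨$⟩ˡ y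
  flip-cong {π} {ρ} π≈ρ y = trans (sym (Perm.inverseˡ ρ)) (cong (ρ ⟨$⟩ˡ_) (trans (sym (π≈ρ _)) (Perm.inverseʳ π)))

  act-congˡ : ∀ {g h} (A : Matrix n) → g ≈G h → act g A ≈ₘ act h A
  act-congˡ {false , α , β} {_ , α′ , β′} A (refl , p , q) i j =
    cong₂ A (flip-cong {α} {α′} p i) (flip-cong {β} {β′} q j)
  act-congˡ {true , α , β} {_ , α′ , β′} A (refl , p , q) i j =
    cong₂ A (flip-cong {β} {β′} q j) (flip-cong {α} {α′} p i)

  ≈ₘ-trans : {A B C : Matrix n} → A ≈ₘ B → B ≈ₘ C → A ≈ₘ C
  ≈ₘ-trans p q i j = trans (p i j) (q i j)

  ≈ₘ-sym : {A B : Matrix n} → A ≈ₘ B → B ≈ₘ A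
  ≈ₘ-sym p i j = sym (p i j)

  _≟ₘ_ : (A B : Matrix n) → Dec (A ≈ₘ B)
  A ≟ₘ B = all? (λ i → all? (λ j → A i j ℕ.≟ B i j))

module _ {n : ℕ} (M : Matrix n) where

  orbitMap : G n → Setoid.Carrier (Orbit M)
  orbitMap g = act g M , g , λ _ _ → refl

  Stabilizer↔Fibre : ∀ N → Inverse (Stabilizer M) (Fibre (G-setoid n) (Orbit M) orbitMap N)
  Stabilizer↔Fibre (N , g , gM≈N) = mkInverseₛ
    (λ (h , hM≈M) → g · h , ≈ₘ-trans (act-· g h M) (≈ₘ-trans (act-congʳ g hM≈M) gM≈N))
    (λ (h , hM≈N) → g ⁻¹ · h , ≈ₘ-trans (act-· (g ⁻¹) h M)
                                 (≈ₘ-trans (act-congʳ (g ⁻¹) (≈ₘ-trans hM≈N (≈ₘ-sym gM≈N))) (act-⁻¹ g M)))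
    (·-congˡ g) (·-congˡ (g ⁻¹))
    (λ (h , _) → ·-inverseʳ g h) (λ (h , _) → ·-inverseˡ g h)

  orbit-stabilizer : ∀ {s} → HasSize (Stabilizer M) s →
    ∃ λ k → HasSize (Orbit M) k × 2 * (n ! * n !) ≡ k * s
  orbit-stabilizer eS = image-size-by-fibres (G-size n) (λ (A , _) (B , _) → A ≟ₘ B) orbitMap
    (λ {g} {h} → act-congˡ M) (λ (N , g , gM≈N) → g , gM≈N) (λ N → ↔ₛ-trans eS (Stabilizer↔Fibre N))

⟨$⟩ʳ-injective : ∀ {n} (π : Permutation′ n) → Injective _≡_ _≡_ (π ⟨$⟩ʳ_)
⟨$⟩ʳ-injective π = Injection.injective (↔⇒↣ π)

module _ {n : ℕ} (π : Permutation′ n) where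

  iter-+ : ∀ a b x → iter π (a + b) x ≡ iter π a (iter π b x)
  iter-+ zero b x = refl
  iter-+ (suc a) b x = cong (π ⟨$⟩ʳ_) (iter-+ a b x)

  iter-comm : ∀ a b x → iter π a (iter π b x) ≡ iter π b (iter π a x)
  iter-comm a b x = trans (sym (iter-+ a b x)) (trans (cong (λ m → iter π m x) (+-comm a b)) (iter-+ b a x))

  iter-suc : ∀ k x → iter π (suc k) x ≡ iter π k (π ⟨$⟩ʳ x)
  iter-suc k x = trans (cong (λ m → iter π m x) (+-comm 1 k)) (iter-+ k 1 x)

module _ {n : ℕ} (π : Permutation′ n) where

  iter⁻ : ℕ → Fin n → Fin n
  iter⁻ = iter (Perm.flip π)

  iter-inverseʳ : ∀ k x → iter π k (iter⁻ k x) ≡ x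
  iter-inverseʳ zero x = refl
  iter-inverseʳ (suc k) x = trans (iter-suc π k _) (trans (cong (iter π k) (Perm.inverseʳ π)) (iter-inverseʳ k x))

  iter-inverseˡ : ∀ k x → iter⁻ k (iter π k x) ≡ x
  iter-inverseˡ zero x = refl
  iter-inverseˡ (suc k) x = trans (iter-suc (Perm.flip π) k _) (trans (cong (iter⁻ k) (Perm.inverseˡ π)) (iter-inverseˡ k x))

  iter⁻-periodic : ∀ L x → iter π L x ≡ x → iter⁻ L x ≡ x
  iter⁻-periodic L x πᴸx≡x = trans (cong (iter⁻ L) (sym πᴸx≡x)) (iter-inverseˡ L x)

  step : Bool → Fin n → Fin n
  step true = π ⟨$⟩ʳ_
  step false = π ⟨$⟩ˡ_

  walk : Bool → ℕ → Fin n → Fin n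
  walk true = iter π
  walk false = iter⁻

  walk-zero : ∀ t y → walk t 0 y ≡ y
  walk-zero true y = refl
  walk-zero false y = refl

  walk-suc : ∀ t k y → walk t (suc k) y ≡ step t (walk t k y)
  walk-suc true k y = refl
  walk-suc false k y = refl

injective⇒surjective : ∀ {n} (f : Fin n → Fin n) → Injective _≡_ _≡_ f → ∀ y → ∃ λ x → f x ≡ y
injective⇒surjective {suc m} f f-injective y with any? (λ x → f x ≟ y)
... | yes hit = hit
... | no miss = ⊥-elim (1+n≰n (injective⇒≤ {f = f′} f′-injective))
  where
  f′ : Fin (suc m) → Fin m
  f′ x = punchOut {i = y} {j = f x} (λ y≡fx → miss (x , sym y≡fx))
  f′-injective : Injective _≡_ _≡_ f′
  f′-injective {x} {x′} e = f-injective (punchOut-injective {i = y} (λ p → miss (x , sym p)) (λ p → miss (x′ , sym p)) e)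

injective⇒permutation : ∀ {n} (f : Fin n → Fin n) → Injective _≡_ _≡_ f → Permutation′ n
injective⇒permutation f f-injective = Perm.permutation f (λ y → proj₁ (surj y))
  (λ y → proj₂ (surj y)) (λ x → f-injective (proj₂ (surj (f x))))
  where
  surj : ∀ y → ∃ λ x → f x ≡ y
  surj = injective⇒surjective f f-injective

-- The matrix I + P σ of a derangement

module _ {n : ℕ} where

  δ-≡ : ∀ {i j : Fin n} → i ≡ j → δ i j ≡ 1
  δ-≡ {i} {j} i≡j with i ≟ j
  ... | yes _ = refl
  ... | no i≢j = ⊥-elim (i≢j i≡j)

  δ-≢ : ∀ {i j : Fin n} → i ≢ j → δ i j ≡ 0
  δ-≢ {i} {j} i≢j with i ≟ j
  ... | yes i≡j = ⊥-elim (i≢j i≡j)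
  ... | no _ = refl

module DerangementMatrix {n : ℕ} (σ : Permutation′ n) (σ-derangement : Derangement σ) where

  next prev : Fin n → Fin n
  next = σ ⟨$⟩ʳ_
  prev = σ ⟨$⟩ˡ_

  prev-≢ : ∀ x → prev x ≢ x
  prev-≢ x p = σ-derangement x (trans (cong next (sym p)) (Perm.inverseʳ σ))

  prev-injective : Injective _≡_ _≡_ prev
  prev-injective = ⟨$⟩ʳ-injective (Perm.flip σ)

  twist : Bool → Fin n → Fin n
  twist true y = y
  twist false y = prev y

  twist-injective : ∀ t {x y} → twist t x ≡ twist t y → x ≡ y
  twist-injective true p = p
  twist-injective false p = prev-injective p

  M : Matrix n
  M = I ⊕ P σ

  Edge : Fin n → Fin n → Set
  Edge i j = i ≡ j ⊎ i ≡ next j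

  Edge? : ∀ i j → Dec (Edge i j)
  Edge? i j with i ≟ j | i ≟ next j
  ... | yes p | _ = yes (inj₁ p)
  ... | no _ | yes q = yes (inj₂ q)
  ... | no p | no q = no λ { (inj₁ x) → p x ; (inj₂ x) → q x }

  M-edge : ∀ {i j} → Edge i j → M i j ≡ 1
  M-edge {i} (inj₁ refl) = cong₂ _+_ (δ-≡ {i = i} refl) (δ-≢ (λ p → σ-derangement i (sym p)))
  M-edge {j = j} (inj₂ refl) = cong₂ _+_ (δ-≢ (σ-derangement j)) (δ-≡ {i = next j} refl)

  M-nonedge : ∀ {i j} → ¬ Edge i j → M i j ≡ 0
  M-nonedge ¬e = cong₂ _+_ (δ-≢ (λ p → ¬e (inj₁ p))) (δ-≢ (λ p → ¬e (inj₂ p)))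

  M-cong : ∀ {i j i′ j′} → (Edge i j → Edge i′ j′) → (Edge i′ j′ → Edge i j) → M i j ≡ M i′ j′
  M-cong {i} {j} ⇒ ⇐ with Edge? i j
  ... | yes e = trans (M-edge e) (sym (M-edge (⇒ e)))
  ... | no ¬e = trans (M-nonedge ¬e) (sym (M-nonedge (λ e′ → ¬e (⇐ e′))))

  M-edge-transport : ∀ {i j i′ j′} → M i j ≡ M i′ j′ → Edge i j → Edge i′ j′
  M-edge-transport {i′ = i′} {j′} p e with Edge? i′ j′
  ... | yes e′ = e′
  ... | no ¬e′ = ⊥-elim (1+n≢0 (trans (sym (M-edge e)) (trans p (M-nonedge ¬e′))))

  Fixes : Permutation′ n → Permutation′ n → Set
  Fixes α β = ∀ i j → M i j ≡ M (α ⟨$⟩ʳ i) (β ⟨$⟩ʳ j)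

  Fixesᵀ : Permutation′ n → Permutation′ n → Set
  Fixesᵀ α β = ∀ i j → M i j ≡ M (α ⟨$⟩ʳ j) (β ⟨$⟩ʳ i)

  module _ (α β : Permutation′ n) where

    act⇒Fixes : act (false , α , β) M ≈ₘ M → Fixes α β
    act⇒Fixes p i j = trans (sym (cong₂ M (Perm.inverseˡ α) (Perm.inverseˡ β))) (p (α ⟨$⟩ʳ i) (β ⟨$⟩ʳ j))

    Fixes⇒act : Fixes α β → act (false , α , β) M ≈ₘ M
    Fixes⇒act fixes i j = trans (fixes _ _) (cong₂ M (Perm.inverseʳ α) (Perm.inverseʳ β))

    actᵀ⇒Fixesᵀ : act (true , α , β) M ≈ₘ M → Fixesᵀ α β
    actᵀ⇒Fixesᵀ p i j = trans (sym (cong₂ M (Perm.inverseˡ β) (Perm.inverseˡ α))) (p (α ⟨$⟩ʳ j) (β ⟨$⟩ʳ i))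

    Fixesᵀ⇒actᵀ : Fixesᵀ α β → act (true , α , β) M ≈ₘ M
    Fixesᵀ⇒actᵀ fixes i j = trans (fixes _ _) (cong₂ M (Perm.inverseʳ α) (Perm.inverseʳ β))

  -- Column j of M has its ones in rows j and σ j; under (α, β) they must land in rows β j and σ (β j).
  Compatible : (Fin n → Fin n) → (Fin n → Fin n) → Fin n → Set
  Compatible a b j = (b j ≡ a j × a (next j) ≡ next (a j)) ⊎ (b j ≡ prev (a j) × a (next j) ≡ prev (a j))

  module _ (α β : Permutation′ n) where

    private
      a b : Fin n → Fin n
      a = α ⟨$⟩ʳ_
      b = β ⟨$⟩ʳ_

      a-injective : Injective _≡_ _≡_ a
      a-injective = ⟨$⟩ʳ-injective α

    Compatible⇒Fixes : (∀ j → Compatible a b j) → Fixes α β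
    Compatible⇒Fixes compatible i j = M-cong forth back
      where
      forth : Edge i j → Edge (a i) (b j)
      forth (inj₁ refl) with compatible i
      ... | inj₁ (p , _) = inj₁ (sym p)
      ... | inj₂ (p , _) = inj₂ (trans (sym (Perm.inverseʳ σ)) (cong next (sym p)))
      forth (inj₂ refl) with compatible j
      ... | inj₁ (p , q) = inj₂ (trans q (cong next (sym p)))
      ... | inj₂ (p , q) = inj₁ (trans q (sym p))
      back : Edge (a i) (b j) → Edge i j
      back (inj₁ e) with compatible j
      ... | inj₁ (p , q) = inj₁ (a-injective (trans e p))
      ... | inj₂ (p , q) = inj₂ (a-injective (trans e (trans p (sym q))))
      back (inj₂ e) with compatible j
      ... | inj₁ (p , q) = inj₂ (a-injective (trans e (trans (cong next p) (sym q))))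
      ... | inj₂ (p , q) = inj₁ (a-injective (trans e (trans (cong next p) (Perm.inverseʳ σ))))

  commutes : Permutation′ n → Permutation′ n → Fin n → Bool
  commutes α β x = does (β ⟨$⟩ʳ x ≟ α ⟨$⟩ʳ x)

  module FixingPair (α β : Permutation′ n) (fixes : Fixes α β) where

    a b : Fin n → Fin n
    a = α ⟨$⟩ʳ_
    b = β ⟨$⟩ʳ_

    a-injective : Injective _≡_ _≡_ a
    a-injective = ⟨$⟩ʳ-injective α

    b-injective : Injective _≡_ _≡_ b
    b-injective = ⟨$⟩ʳ-injective β

    compatible : ∀ j → Compatible a b j
    compatible j with M-edge-transport {j} {j} (fixes j j) (inj₁ refl)
                    | M-edge-transport {next j} {j} (fixes (next j) j) (inj₂ refl)
    ... | inj₁ p | inj₁ q = ⊥-elim (σ-derangement j (sym (a-injective (trans p (sym q)))))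
    ... | inj₁ p | inj₂ q = inj₁ (sym p , trans q (cong next (sym p)))
    ... | inj₂ p | inj₁ q = inj₂ (trans (sym (Perm.inverseˡ σ)) (cong prev (sym p)) ,
                                  trans q (trans (sym (Perm.inverseˡ σ)) (cong prev (sym p))))
    ... | inj₂ p | inj₂ q = ⊥-elim (σ-derangement j (sym (a-injective (trans p (sym q)))))

    commuting : ∀ j → b j ≡ a j → a (next j) ≡ next (a j)
    commuting j b≡a with compatible j
    ... | inj₁ (_ , q) = q
    ... | inj₂ (p , _) = ⊥-elim (prev-≢ (a j) (trans (sym p) b≡a))

    reversing : ∀ j → b j ≢ a j → b j ≡ prev (a j) × a (next j) ≡ prev (a j)
    reversing j b≢a with compatible j
    ... | inj₁ (p , _) = ⊥-elim (b≢a p)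
    ... | inj₂ pq = pq

    commuting-next : ∀ j → b j ≡ a j → b (next j) ≡ a (next j)
    commuting-next j b≡a with compatible (next j)
    ... | inj₁ (p , _) = p
    ... | inj₂ (p , _) = ⊥-elim (σ-derangement j (b-injective (trans p (trans (cong prev (commuting j b≡a))
                                   (trans (Perm.inverseˡ σ) (sym b≡a))))))

    reversing-next : ∀ j → b j ≢ a j → b (next j) ≢ a (next j)
    reversing-next j b≢a p = σ-derangement j (b-injective (trans p (trans (proj₂ (reversing j b≢a)) (sym (proj₁ (reversing j b≢a))))))

    commuting-orbit : ∀ x → b x ≡ a x → ∀ k → a (iter σ k x) ≡ iter σ k (a x) × b (iter σ k x) ≡ a (iter σ k x)
    commuting-orbit x b≡a zero = refl , b≡a
    commuting-orbit x b≡a (suc k) = let (p , q) = commuting-orbit x b≡a k in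
      trans (commuting _ q) (cong next p) , commuting-next _ q

    reversing-orbit : ∀ x → b x ≢ a x → ∀ k → a (iter σ k x) ≡ iter⁻ σ k (a x) × b (iter σ k x) ≢ a (iter σ k x)
    reversing-orbit x b≢a zero = refl , b≢a
    reversing-orbit x b≢a (suc k) = let (p , q) = reversing-orbit x b≢a k in
      trans (proj₂ (reversing _ q)) (cong prev p) , reversing-next _ q

    along-orbit : ∀ x k → a (iter σ k x) ≡ walk σ (commutes α β x) k (a x) ×
                          b (iter σ k x) ≡ twist (commutes α β x) (a (iter σ k x))
    along-orbit x k with b x ≟ a x
    ... | yes b≡a = commuting-orbit x b≡a k
    ... | no b≢a = let (p , q) = reversing-orbit x b≢a k in p , proj₁ (reversing _ q)

  FixingPairs : Setoid 0ℓ 0ℓ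
  FixingPairs = record
    { Carrier = Σ (Permutation′ n × Permutation′ n) (λ (α , β) → Fixes α β)
    ; _≈_ = λ ((α , β) , _) ((α′ , β′) , _) → α Perm.≈ α′ × β Perm.≈ β′
    ; isEquivalence = record
      { refl = (λ _ → refl) , (λ _ → refl)
      ; sym = λ (p , q) → (λ x → sym (p x)) , (λ x → sym (q x))
      ; trans = λ (p , q) (p′ , q′) → (λ x → trans (p x) (p′ x)) , (λ x → trans (q x) (q′ x)) } }

  -- A permutation ρ conjugating σ to σ⁻¹ realises the transpose: Mᵀ = P_ρ⁻¹ M P_ρ.
  module _ (ρ : Permutation′ n) (ρ-reverses : ∀ y → ρ ⟨$⟩ʳ next y ≡ prev (ρ ⟨$⟩ʳ y)) where

    M-transpose : ∀ u v → M u v ≡ M (ρ ⟨$⟩ʳ v) (ρ ⟨$⟩ʳ u)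
    M-transpose u v = M-cong forth back
      where
      forth : Edge u v → Edge (ρ ⟨$⟩ʳ v) (ρ ⟨$⟩ʳ u)
      forth (inj₁ refl) = inj₁ refl
      forth (inj₂ refl) = inj₂ (trans (sym (Perm.inverseʳ σ)) (cong next (sym (ρ-reverses v))))
      back : Edge (ρ ⟨$⟩ʳ v) (ρ ⟨$⟩ʳ u) → Edge u v
      back (inj₁ p) = inj₁ (sym (⟨$⟩ʳ-injective ρ p))
      back (inj₂ p) = inj₂ (sym (⟨$⟩ʳ-injective ρ (trans (ρ-reverses v) (trans (cong prev p) (Perm.inverseˡ σ)))))

    Fixesᵀ⇒Fixes : ∀ α β → Fixesᵀ α β → Fixes (β ∘ₚ ρ) (α ∘ₚ ρ)
    Fixesᵀ⇒Fixes α β fixes i j = trans (fixes i j) (M-transpose (α ⟨$⟩ʳ j) (β ⟨$⟩ʳ i))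

    Fixes⇒Fixesᵀ : ∀ α β → Fixes α β → Fixesᵀ (β ∘ₚ Perm.flip ρ) (α ∘ₚ Perm.flip ρ)
    Fixes⇒Fixesᵀ α β fixes i j = trans (fixes i j) (sym (trans (M-transpose _ _) (cong₂ M (Perm.inverseʳ ρ) (Perm.inverseʳ ρ))))

    Stabilizer↔Bool×FixingPairs : Inverse (Stabilizer M) (≡.setoid Bool ×ₛ FixingPairs)
    Stabilizer↔Bool×FixingPairs = mkInverseₛ to from to-cong from-cong to∘from from∘to
      where
      to : Setoid.Carrier (Stabilizer M) → Setoid.Carrier (≡.setoid Bool ×ₛ FixingPairs)
      to ((false , α , β) , p) = false , (α , β) , act⇒Fixes α β p
      to ((true , α , β) , p) = true , (β ∘ₚ ρ , α ∘ₚ ρ) , Fixesᵀ⇒Fixes α β (actᵀ⇒Fixesᵀ α β p)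

      from : Setoid.Carrier (≡.setoid Bool ×ₛ FixingPairs) → Setoid.Carrier (Stabilizer M)
      from (false , (α , β) , fixes) = (false , α , β) , Fixes⇒act α β fixes
      from (true , (α , β) , fixes) = (true , β ∘ₚ Perm.flip ρ , α ∘ₚ Perm.flip ρ) ,
        Fixesᵀ⇒actᵀ (β ∘ₚ Perm.flip ρ) (α ∘ₚ Perm.flip ρ) (Fixes⇒Fixesᵀ α β fixes)

      to-cong : ∀ {x y} → Setoid._≈_ (Stabilizer M) x y → Setoid._≈_ (≡.setoid Bool ×ₛ FixingPairs) (to x) (to y)
      to-cong {(false , _) , _} (refl , p , q) = refl , p , q
      to-cong {(true , _) , _} (refl , p , q) = refl , (λ x → cong (ρ ⟨$⟩ʳ_) (q x)) , (λ x → cong (ρ ⟨$⟩ʳ_) (p x))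

      from-cong : ∀ {x y} → Setoid._≈_ (≡.setoid Bool ×ₛ FixingPairs) x y → Setoid._≈_ (Stabilizer M) (from x) (from y)
      from-cong {false , _} (refl , p , q) = refl , p , q
      from-cong {true , _} (refl , p , q) = refl , (λ x → cong (ρ ⟨$⟩ˡ_) (q x)) , (λ x → cong (ρ ⟨$⟩ˡ_) (p x))

      to∘from : ∀ y → Setoid._≈_ (≡.setoid Bool ×ₛ FixingPairs) (to (from y)) y
      to∘from (false , _) = refl , (λ _ → refl) , (λ _ → refl)
      to∘from (true , _) = refl , (λ _ → Perm.inverseʳ ρ) , (λ _ → Perm.inverseʳ ρ)

      from∘to : ∀ x → Setoid._≈_ (Stabilizer M) (from (to x)) x
      from∘to ((false , _) , _) = refl , (λ _ → refl) , (λ _ → refl)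
      from∘to ((true , _) , _) = refl , (λ _ → Perm.inverseˡ ρ) , (λ _ → Perm.inverseˡ ρ)

-- Derangements with two cycles

module TwoCycles {n : ℕ} (σ : Permutation′ n) (σ-derangement : Derangement σ) {n₁ n₂ : ℕ}
                 (cycles : TwoCycleProduct σ n₁ n₂) (n₁>0 : 0 < n₁) (n₂>0 : 0 < n₂) where

  open DerangementMatrix σ σ-derangement

  start : Bool → Fin n
  start true = proj₁ cycles
  start false = proj₁ (proj₂ cycles)

  length : Bool → ℕ
  length true = n₁
  length false = n₂

  length>0 : ∀ c → 0 < length c
  length>0 true = n₁>0
  length>0 false = n₂>0

  point : Bool → ℕ → Fin n
  point c k = iter σ k (start c)

  closes : ∀ c → iter σ (length c) (start c) ≡ start c
  closes true = let (_ , _ , closes₁ , _) = cycles in closes₁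
  closes false = let (_ , _ , _ , closes₂ , _) = cycles in closes₂

  point-injective : ∀ c c′ k k′ → k < length c → k′ < length c′ → point c k ≡ point c′ k′ → c ≡ c′ × k ≡ k′
  point-injective true true k k′ k< k′< p =
    let (_ , _ , _ , _ , distinct₁ , _) = cycles in refl , distinct₁ k k′ k< k′< p
  point-injective true false k k′ k< k′< p =
    let (_ , _ , _ , _ , _ , _ , disjoint , _) = cycles in ⊥-elim (disjoint k k′ k< k′< p)
  point-injective false true k k′ k< k′< p =
    let (_ , _ , _ , _ , _ , _ , disjoint , _) = cycles in ⊥-elim (disjoint k′ k k′< k< (sym p))
  point-injective false false k k′ k< k′< p =
    let (_ , _ , _ , _ , _ , distinct₂ , _) = cycles in refl , distinct₂ k k′ k< k′< p

  locate : ∀ y → Σ Bool λ c → Σ ℕ λ k → k < length c × point c k ≡ y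
  locate y = let (_ , _ , _ , _ , _ , _ , _ , covers) = cycles in
    [ (λ (k , k< , p) → true , k , k< , p) , (λ (k , k< , p) → false , k , k< , p) ]′ (covers y)

  cycleOf : Fin n → Bool
  cycleOf y = proj₁ (locate y)

  indexOf : Fin n → ℕ
  indexOf y = proj₁ (proj₂ (locate y))

  indexOf< : ∀ y → indexOf y < length (cycleOf y)
  indexOf< y = proj₁ (proj₂ (proj₂ (locate y)))

  point-indexOf : ∀ y → point (cycleOf y) (indexOf y) ≡ y
  point-indexOf y = proj₂ (proj₂ (proj₂ (locate y)))

  locate-point : ∀ c k y → k < length c → point c k ≡ y → cycleOf y ≡ c × indexOf y ≡ k
  locate-point c k y k< p = point-injective _ c _ k (indexOf< y) k< (trans (point-indexOf y) (sym p))

  cycleOf-start : ∀ c → cycleOf (start c) ≡ c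
  cycleOf-start c = proj₁ (locate-point c 0 (start c) (length>0 c) refl)

  cycleOf-next : ∀ y → cycleOf (next y) ≡ cycleOf y
  cycleOf-next y with <-cmp (suc (indexOf y)) (length (cycleOf y))
  ... | tri< k< _ _ = proj₁ (locate-point _ (suc (indexOf y)) (next y) k< (cong next (point-indexOf y)))
  ... | tri≈ _ k≡ _ = proj₁ (locate-point _ 0 (next y) (length>0 (cycleOf y))
          (trans (sym (closes (cycleOf y))) (trans (cong (point (cycleOf y)) (sym k≡)) (cong next (point-indexOf y)))))
  ... | tri> _ _ k> = ⊥-elim (<-irrefl refl (<-≤-trans k> (indexOf< y)))

  cycleOf-prev : ∀ y → cycleOf (prev y) ≡ cycleOf y
  cycleOf-prev y = trans (sym (cycleOf-next (prev y))) (cong cycleOf (Perm.inverseʳ σ))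

  cycleOf-iter : ∀ k y → cycleOf (iter σ k y) ≡ cycleOf y
  cycleOf-iter zero y = refl
  cycleOf-iter (suc k) y = trans (cycleOf-next _) (cycleOf-iter k y)

  cycleOf-iter⁻ : ∀ k y → cycleOf (iter⁻ σ k y) ≡ cycleOf y
  cycleOf-iter⁻ zero y = refl
  cycleOf-iter⁻ (suc k) y = trans (cycleOf-prev _) (cycleOf-iter⁻ k y)

  cycleOf-point : ∀ c k → cycleOf (point c k) ≡ c
  cycleOf-point c k = trans (cycleOf-iter k (start c)) (cycleOf-start c)

  point-periodic : ∀ c k → iter σ (length c) (point c k) ≡ point c k
  point-periodic c k = trans (iter-comm σ (length c) k (start c)) (cong (iter σ k) (closes c))

  periodic : ∀ y → iter σ (length (cycleOf y)) y ≡ y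
  periodic y = subst (λ z → iter σ (length (cycleOf y)) z ≡ z) (point-indexOf y) (point-periodic (cycleOf y) (indexOf y))

  rewind : ∀ y → iter σ (length (cycleOf y) ∸ indexOf y) y ≡ start (cycleOf y)
  rewind y = let c = cycleOf y; p = indexOf y in begin
    iter σ (length c ∸ p) y                  ≡⟨ cong (iter σ (length c ∸ p)) (sym (point-indexOf y)) ⟩
    iter σ (length c ∸ p) (iter σ p (start c)) ≡⟨ sym (iter-+ σ (length c ∸ p) p (start c)) ⟩
    iter σ (length c ∸ p + p) (start c)      ≡⟨ cong (λ m → iter σ m (start c)) (m∸n+n≡m (<⇒≤ (indexOf< y))) ⟩
    iter σ (length c) (start c)              ≡⟨ closes c ⟩
    start c                                  ∎

  same-cycle⇒iter : ∀ y z → cycleOf y ≡ cycleOf z → ∃ λ m → iter σ m y ≡ z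
  same-cycle⇒iter y z same = indexOf z + (length (cycleOf y) ∸ indexOf y) , (begin
    iter σ (indexOf z + (length (cycleOf y) ∸ indexOf y)) y ≡⟨ iter-+ σ (indexOf z) _ y ⟩
    iter σ (indexOf z) (iter σ (length (cycleOf y) ∸ indexOf y) y) ≡⟨ cong (iter σ (indexOf z)) (rewind y) ⟩
    point (cycleOf y) (indexOf z) ≡⟨ cong (λ c → point c (indexOf z)) same ⟩
    point (cycleOf z) (indexOf z) ≡⟨ point-indexOf z ⟩
    z ∎)

  iter-injective-below-length : ∀ y k k′ → k < length (cycleOf y) → k′ < length (cycleOf y) →
                                iter σ k y ≡ iter σ k′ y → k ≡ k′
  iter-injective-below-length y k k′ k< k′< p = proj₂ (point-injective _ _ k k′ k< k′< (begin
    point (cycleOf y) k ≡⟨ cong (iter σ k) (sym (rewind y)) ⟩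
    iter σ k (iter σ r y) ≡⟨ iter-comm σ k r y ⟩
    iter σ r (iter σ k y) ≡⟨ cong (iter σ r) p ⟩
    iter σ r (iter σ k′ y) ≡⟨ iter-comm σ r k′ y ⟩
    iter σ k′ (iter σ r y) ≡⟨ cong (iter σ k′) (rewind y) ⟩
    point (cycleOf y) k′ ∎))
    where
    r = length (cycleOf y) ∸ indexOf y

  cycleOf-walk : ∀ r k y → cycleOf (walk σ r k y) ≡ cycleOf y
  cycleOf-walk true = cycleOf-iter
  cycleOf-walk false = cycleOf-iter⁻

  walk-periodic : ∀ r y → walk σ r (length (cycleOf y)) y ≡ y
  walk-periodic true y = periodic y
  walk-periodic false y = iter⁻-periodic σ (length (cycleOf y)) y (periodic y)

  walk-injective-below-length : ∀ r y k k′ → k < length (cycleOf y) → k′ < length (cycleOf y) →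
                                walk σ r k y ≡ walk σ r k′ y → k ≡ k′
  walk-injective-below-length true = iter-injective-below-length
  walk-injective-below-length false y k k′ k< k′< p = sym (iter-injective-below-length y k′ k k′< k< (begin
    iter σ k′ y                          ≡⟨ cong (iter σ k′) (sym (iter-inverseʳ σ k y)) ⟩
    iter σ k′ (iter σ k (iter⁻ σ k y))   ≡⟨ cong (λ w → iter σ k′ (iter σ k w)) p ⟩
    iter σ k′ (iter σ k (iter⁻ σ k′ y))  ≡⟨ iter-comm σ k′ k _ ⟩
    iter σ k (iter σ k′ (iter⁻ σ k′ y))  ≡⟨ cong (iter σ k) (iter-inverseʳ σ k′ y) ⟩
    iter σ k y                           ∎))

  walk-reaches : ∀ t y z → cycleOf y ≡ cycleOf z → ∃ λ m → walk σ t m y ≡ z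
  walk-reaches true y z same = same-cycle⇒iter y z same
  walk-reaches false y z same = let (m , reaches) = same-cycle⇒iter z y (sym same) in
    m , trans (cong (iter⁻ σ m) (sym reaches)) (iter-inverseˡ σ m z)

  cycleOf-twist : ∀ r y → cycleOf (twist r y) ≡ cycleOf y
  cycleOf-twist true y = refl
  cycleOf-twist false y = cycleOf-prev y

  xor-length : ∀ s → (s ≡ true → n₁ ≡ n₂) → ∀ c → length (s xor c) ≡ length c
  xor-length false _ c = refl
  xor-length true equal true = sym (equal refl)
  xor-length true equal false = equal refl

  module _ (α β : Permutation′ n) (fixes : Fixes α β) where

    open FixingPair α β fixes

    private
      start-orbits-disjoint : ∀ m → iter σ m (start true) ≢ start false
      start-orbits-disjoint m p with trans (sym (cycleOf-point true m)) (trans (cong cycleOf p) (cycleOf-start false))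
      ... | ()

    cycles-separated : cycleOf (a (start true)) ≢ cycleOf (a (start false))
    cycles-separated same = let (m , reaches) = walk-reaches (commutes α β (start true)) _ _ same in
      start-orbits-disjoint m (a-injective (trans (proj₁ (along-orbit (start true) m)) reaches))

    image-period : ∀ c → iter σ (length (cycleOf (a (start c)))) (start c) ≡ start c
    image-period c = a-injective (trans (proj₁ (along-orbit (start c) (length (cycleOf (a (start c))))))
                                       (walk-periodic (commutes α β (start c)) (a (start c))))

    image-length-≮ : ∀ c d → cycleOf (a (start c)) ≡ d → ¬ length d < length c
    image-length-≮ c d refl d<c = <-irrefl (sym L≡0) (length>0 d)
      where
      L≡0 : length d ≡ 0
      L≡0 = proj₂ (point-injective c c _ 0 d<c (length>0 c) (image-period c))

    swaps : Bool
    swaps = not (cycleOf (a (start true)))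

    swaps⇒equal-lengths : swaps ≡ true → n₁ ≡ n₂
    swaps⇒equal-lengths swaps≡true with <-cmp n₁ n₂
    ... | tri< n₁<n₂ _ _ = ⊥-elim (image-length-≮ false true
            (¬-not (λ p → cycles-separated (trans x₁-swapped (sym p)))) n₁<n₂)
      where x₁-swapped = trans (sym (not-involutive _)) (cong not swaps≡true)
    ... | tri≈ _ n₁≡n₂ _ = n₁≡n₂
    ... | tri> _ _ n₂<n₁ = ⊥-elim (image-length-≮ true false
            (trans (sym (not-involutive _)) (cong not swaps≡true)) n₂<n₁)

    cycleOf-a-start : ∀ c → cycleOf (a (start c)) ≡ swaps xor c
    cycleOf-a-start true = sym (trans (xor-comm swaps true) (not-involutive _))
    cycleOf-a-start false = trans (¬-not (λ p → cycles-separated (sym p))) (sym (xor-identityʳ swaps))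

    indexOf-a-start< : ∀ c → indexOf (a (start c)) < length c
    indexOf-a-start< c = subst (indexOf (a (start c)) <_)
      (trans (cong length (cycleOf-a-start c)) (xor-length swaps swaps⇒equal-lengths c)) (indexOf< _)

  fixing-pair-unique : ∀ {α β α′ β′} → Fixes α β → Fixes α′ β′ →
    (∀ c → α ⟨$⟩ʳ start c ≡ α′ ⟨$⟩ʳ start c) →
    (∀ c → commutes α β (start c) ≡ commutes α′ β′ (start c)) →
    α Perm.≈ α′ × β Perm.≈ β′
  fixing-pair-unique {α} {β} {α′} {β′} fixes fixes′ same-start same-commutes =
    (λ z → proj₁ (on z)) , (λ z → proj₂ (on z))
    where
    module P = FixingPair α β fixes
    module P′ = FixingPair α′ β′ fixes′

    on-point : ∀ c k → P.a (point c k) ≡ P′.a (point c k) × P.b (point c k) ≡ P′.b (point c k)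
    on-point c k = a≡a′ , (begin
      P.b (point c k)                                     ≡⟨ proj₂ (P.along-orbit (start c) k) ⟩
      twist (commutes α β (start c)) (P.a (point c k))    ≡⟨ cong₂ twist (same-commutes c) a≡a′ ⟩
      twist (commutes α′ β′ (start c)) (P′.a (point c k)) ≡⟨ sym (proj₂ (P′.along-orbit (start c) k)) ⟩
      P′.b (point c k)                                    ∎)
      where
      a≡a′ : P.a (point c k) ≡ P′.a (point c k)
      a≡a′ = begin
        P.a (point c k)                                      ≡⟨ proj₁ (P.along-orbit (start c) k) ⟩
        walk σ (commutes α β (start c)) k (P.a (start c))    ≡⟨ cong₂ (λ t y → walk σ t k y) (same-commutes c) (same-start c) ⟩
        walk σ (commutes α′ β′ (start c)) k (P′.a (start c)) ≡⟨ sym (proj₁ (P′.along-orbit (start c) k)) ⟩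
        P′.a (point c k)                                     ∎

    on : ∀ z → P.a z ≡ P′.a z × P.b z ≡ P′.b z
    on z = subst (λ w → P.a w ≡ P′.a w × P.b w ≡ P′.b w) (point-indexOf z) (on-point (cycleOf z) (indexOf z))

  xor-injective : ∀ s {c c′} → s xor c ≡ s xor c′ → c ≡ c′
  xor-injective true {true} {true} _ = refl
  xor-injective true {false} {false} _ = refl
  xor-injective false p = p

  module Construction (s : Bool) (target : Bool → ℕ) (r : Bool → Bool)
                      (target< : ∀ c → target c < length (s xor c))
                      (lengths : ∀ c → length (s xor c) ≡ length c) where

    base : Bool → Fin n
    base c = point (s xor c) (target c)

    cycleOf-base : ∀ c → cycleOf (base c) ≡ s xor c
    cycleOf-base c = cycleOf-point (s xor c) (target c)

    length-base : ∀ c → length (cycleOf (base c)) ≡ length c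
    length-base c = trans (cong length (cycleOf-base c)) (lengths c)

    image : Bool → ℕ → Fin n
    image c k = walk σ (r c) k (base c)

    image-injective : ∀ c c′ k k′ → k < length c → k′ < length c′ → image c k ≡ image c′ k′ → c ≡ c′ × k ≡ k′
    image-injective c c′ k k′ k< k′< p with xor-injective s (begin
      s xor c                   ≡⟨ sym (trans (cycleOf-walk (r c) k _) (cycleOf-base c)) ⟩
      cycleOf (image c k)       ≡⟨ cong cycleOf p ⟩
      cycleOf (image c′ k′)     ≡⟨ trans (cycleOf-walk (r c′) k′ _) (cycleOf-base c′) ⟩
      s xor c′                  ∎)
    ... | refl = refl , walk-injective-below-length (r c) (base c) k k′
                          (subst (k <_) (sym (length-base c)) k<) (subst (k′ <_) (sym (length-base c)) k′<) p

    image-periodic : ∀ c → image c (length c) ≡ image c 0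
    image-periodic c = begin
      walk σ (r c) (length c) (base c)                  ≡⟨ cong (λ L → walk σ (r c) L (base c)) (sym (length-base c)) ⟩
      walk σ (r c) (length (cycleOf (base c))) (base c) ≡⟨ walk-periodic (r c) (base c) ⟩
      base c                                            ≡⟨ sym (walk-zero σ (r c) (base c)) ⟩
      walk σ (r c) 0 (base c)                           ∎

    a : Fin n → Fin n
    a y = image (cycleOf y) (indexOf y)

    b : Fin n → Fin n
    b y = twist (r (cycleOf y)) (a y)

    a-point< : ∀ c k → k < length c → a (point c k) ≡ image c k
    a-point< c k k< = let (same-c , same-k) = locate-point c k (point c k) k< refl in cong₂ image same-c same-k

    a-point : ∀ c k → k ≤ length c → a (point c k) ≡ image c k
    a-point c k k≤ with m≤n⇒m<n∨m≡n k≤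
    ... | inj₁ k< = a-point< c k k<
    ... | inj₂ refl = trans (cong a (closes c)) (trans (a-point< c 0 (length>0 c)) (sym (image-periodic c)))

    a-next : ∀ j → a (next j) ≡ step σ (r (cycleOf j)) (a j)
    a-next j = begin
      a (next j)                              ≡⟨ cong (λ y → a (next y)) (sym (point-indexOf j)) ⟩
      a (point (cycleOf j) (suc (indexOf j))) ≡⟨ a-point (cycleOf j) (suc (indexOf j)) (indexOf< j) ⟩
      image (cycleOf j) (suc (indexOf j))     ≡⟨ walk-suc σ (r (cycleOf j)) (indexOf j) _ ⟩
      step σ (r (cycleOf j)) (a j)            ∎

    a-injective : ∀ {y y′} → a y ≡ a y′ → y ≡ y′
    a-injective {y} {y′} p with image-injective _ _ _ _ (indexOf< y) (indexOf< y′) p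
    ... | same-c , same-k = trans (sym (point-indexOf y)) (trans (cong₂ point same-c same-k) (point-indexOf y′))

    cycleOf-a : ∀ y → cycleOf (a y) ≡ s xor cycleOf y
    cycleOf-a y = trans (cycleOf-walk (r (cycleOf y)) (indexOf y) _) (cycleOf-base (cycleOf y))

    b-injective : ∀ {y y′} → b y ≡ b y′ → y ≡ y′
    b-injective {y} {y′} p = a-injective (twist-injective (r (cycleOf y))
      (trans p (cong (λ c → twist (r c) (a y′)) (sym same-cycle))))
      where
      same-cycle : cycleOf y ≡ cycleOf y′
      same-cycle = xor-injective s (begin
        s xor cycleOf y  ≡⟨ sym (trans (cycleOf-twist (r (cycleOf y)) (a y)) (cycleOf-a y)) ⟩
        cycleOf (b y)    ≡⟨ cong cycleOf p ⟩
        cycleOf (b y′)   ≡⟨ trans (cycleOf-twist (r (cycleOf y′)) (a y′)) (cycleOf-a y′) ⟩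
        s xor cycleOf y′ ∎)

    compatible : ∀ j → Compatible a b j
    compatible j = by-bit (r (cycleOf j)) (a-next j) refl
      where
      by-bit : ∀ t → a (next j) ≡ step σ t (a j) → b j ≡ twist t (a j) → Compatible a b j
      by-bit true p q = inj₁ (q , p)
      by-bit false p q = inj₂ (q , p)

    α β : Permutation′ n
    α = injective⇒permutation a a-injective
    β = injective⇒permutation b b-injective

    fixes : Fixes α β
    fixes = Compatible⇒Fixes α β compatible

    a-start : ∀ c → a (start c) ≡ base c
    a-start c = trans (a-point< c 0 (length>0 c)) (walk-zero σ (r c) (base c))

    cycleOf-α-start : ∀ c → cycleOf (α ⟨$⟩ʳ start c) ≡ s xor c
    cycleOf-α-start c = trans (cong cycleOf (a-start c)) (cycleOf-base c)

    indexOf-α-start : ∀ c → indexOf (α ⟨$⟩ʳ start c) ≡ target c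
    indexOf-α-start c = proj₂ (locate-point (s xor c) (target c) _ (target< c) (sym (a-start c)))

    commutes-start : ∀ c → commutes α β (start c) ≡ r c
    commutes-start c = trans (cong (λ d → does (twist (r d) (a (start c)) ≟ a (start c))) (cycleOf-start c))
                             (twist-commutes (r c) (a (start c)))
      where
      twist-commutes : ∀ t y → does (twist t y ≟ y) ≡ t
      twist-commutes true y with y ≟ y
      ... | yes _ = refl
      ... | no y≢y = ⊥-elim (y≢y refl)
      twist-commutes false y with prev y ≟ y
      ... | yes p = ⊥-elim (prev-≢ y p)
      ... | no _ = refl

  -- whether α exchanges the two cycles, which requires them to have equal length
  Swaps : Setoid 0ℓ 0ℓ
  Swaps = record
    { Carrier = Σ Bool (λ s → s ≡ true → n₁ ≡ n₂) ; _≈_ = λ x y → proj₁ x ≡ proj₁ y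
    ; isEquivalence = record { refl = refl ; sym = sym ; trans = trans } }

  -- swap, then position of α (start c) on its cycle and commute bit at start c, for c = true, false
  Descriptions : Setoid 0ℓ 0ℓ
  Descriptions = Swaps ×ₛ (≡.setoid (Fin n₁) ×ₛ (≡.setoid Bool ×ₛ (≡.setoid (Fin n₂) ×ₛ ≡.setoid Bool)))

  target : Fin n₁ → Fin n₂ → Bool → ℕ
  target i₁ i₂ c = if c then toℕ i₁ else toℕ i₂

  target<length : ∀ i₁ i₂ c → target i₁ i₂ c < length c
  target<length i₁ i₂ true = toℕ<n i₁
  target<length i₁ i₂ false = toℕ<n i₂

  module Described (s : Bool) (allowed : s ≡ true → n₁ ≡ n₂) (i₁ : Fin n₁) (r₁ : Bool) (i₂ : Fin n₂) (r₂ : Bool) =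
    Construction s (target i₁ i₂) (λ c → if c then r₁ else r₂)
      (λ c → subst (target i₁ i₂ c <_) (sym (xor-length s allowed c)) (target<length i₁ i₂ c))
      (xor-length s allowed)

  point-at : ∀ y {c k} → cycleOf y ≡ c → indexOf y ≡ k → point c k ≡ y
  point-at y refl refl = point-indexOf y

  Descriptions↔FixingPairs : Inverse Descriptions FixingPairs
  Descriptions↔FixingPairs = mkInverseₛ to from (λ {x} {y} → to-cong {x} {y}) (λ {x} {y} → from-cong {x} {y}) to∘from from∘to
    where
    to : Setoid.Carrier Descriptions → Setoid.Carrier FixingPairs
    to ((s , allowed) , i₁ , r₁ , i₂ , r₂) = (D.α , D.β) , D.fixes
      where module D = Described s allowed i₁ r₁ i₂ r₂

    from : Setoid.Carrier FixingPairs → Setoid.Carrier Descriptions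
    from ((α , β) , fixes) =
      (swaps α β fixes , swaps⇒equal-lengths α β fixes) ,
      fromℕ< (indexOf-a-start< α β fixes true) , commutes α β (start true) ,
      fromℕ< (indexOf-a-start< α β fixes false) , commutes α β (start false)

    to-cong : ∀ {x y} → Setoid._≈_ Descriptions x y → Setoid._≈_ FixingPairs (to x) (to y)
    to-cong {(s , _) , i₁ , r₁ , i₂ , r₂} (refl , refl , refl , refl , refl) = (λ _ → refl) , (λ _ → refl)

    from-cong : ∀ {x y} → Setoid._≈_ FixingPairs x y → Setoid._≈_ Descriptions (from x) (from y)
    from-cong {(α , β) , _} {(α′ , β′) , _} (α≈α′ , β≈β′) =
      cong (λ y → not (cycleOf y)) (α≈α′ (start true)) ,
      fromℕ<-cong _ _ (cong indexOf (α≈α′ (start true))) _ _ , same-commutes true ,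
      fromℕ<-cong _ _ (cong indexOf (α≈α′ (start false))) _ _ , same-commutes false
      where
      same-commutes : ∀ c → commutes α β (start c) ≡ commutes α′ β′ (start c)
      same-commutes c = cong₂ (λ u v → does (v ≟ u)) (α≈α′ (start c)) (β≈β′ (start c))

    to∘from : ∀ y → Setoid._≈_ FixingPairs (to (from y)) y
    to∘from ((α , β) , fixes) = fixing-pair-unique {D.α} {D.β} {α} {β} D.fixes fixes same-start same-commutes
      where
      module D = Described (swaps α β fixes) (swaps⇒equal-lengths α β fixes)
        (fromℕ< (indexOf-a-start< α β fixes true)) (commutes α β (start true))
        (fromℕ< (indexOf-a-start< α β fixes false)) (commutes α β (start false))
      same-target : ∀ c → D.base c ≡ α ⟨$⟩ʳ start c
      same-target true = point-at _ (cycleOf-a-start α β fixes true) (sym (toℕ-fromℕ< _))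
      same-target false = point-at _ (cycleOf-a-start α β fixes false) (sym (toℕ-fromℕ< _))
      same-start : ∀ c → D.α ⟨$⟩ʳ start c ≡ α ⟨$⟩ʳ start c
      same-start c = trans (D.a-start c) (same-target c)
      same-commutes : ∀ c → commutes D.α D.β (start c) ≡ commutes α β (start c)
      same-commutes true = D.commutes-start true
      same-commutes false = D.commutes-start false

    from∘to : ∀ x → Setoid._≈_ Descriptions (from (to x)) x
    from∘to ((s , allowed) , i₁ , r₁ , i₂ , r₂) =
      trans (cong not (D.cycleOf-α-start true)) (trans (not-distribʳ-xor s true) (xor-identityʳ s)) ,
      trans (fromℕ<-cong _ _ (D.indexOf-α-start true) _ (toℕ<n i₁)) (fromℕ<-toℕ i₁ _) ,
      D.commutes-start true ,
      trans (fromℕ<-cong _ _ (D.indexOf-α-start false) _ (toℕ<n i₂)) (fromℕ<-toℕ i₂ _) ,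
      D.commutes-start false
      where module D = Described s allowed i₁ r₁ i₂ r₂

  Swaps-size-≢ : n₁ ≢ n₂ → HasSize Swaps 1
  Swaps-size-≢ n₁≢n₂ = mkInverseₛ (λ _ → false , λ ()) (λ _ → zero) (λ _ → refl) (λ _ → refl)
    no-swap (λ { zero → refl })
    where
    no-swap : ∀ x → false ≡ proj₁ x
    no-swap (false , _) = refl
    no-swap (true , allowed) = ⊥-elim (n₁≢n₂ (allowed refl))

  Swaps-size-≡ : n₁ ≡ n₂ → HasSize Swaps 2
  Swaps-size-≡ n₁≡n₂ = mkInverseₛ (λ i → to i , λ _ → n₁≡n₂) (λ x → from (proj₁ x)) (cong to) (cong from)
    (λ x → strictlyInverseˡ (proj₁ x)) strictlyInverseʳ
    where open Inverse 2↔Bool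

  reversal : Permutation′ n
  reversal = Construction.α false (λ _ → 0) (λ _ → false) length>0 (λ _ → refl)

  reversal-reverses : ∀ y → reversal ⟨$⟩ʳ next y ≡ prev (reversal ⟨$⟩ʳ y)
  reversal-reverses = Construction.a-next false (λ _ → 0) (λ _ → false) length>0 (λ _ → refl)

  Stabilizer-size : ∀ {k} → HasSize Swaps k → HasSize (Stabilizer M) (2 * (k * (n₁ * (2 * (n₂ * 2)))))
  Stabilizer-size {k} swaps-size = ↔ₛ-trans
    (HasSize-× HasSize-Bool (↔ₛ-trans description-size Descriptions↔FixingPairs))
    (↔ₛ-sym (Stabilizer↔Bool×FixingPairs reversal reversal-reverses))
    where
    description-size : HasSize Descriptions (k * (n₁ * (2 * (n₂ * 2))))
    description-size = HasSize-× swaps-size (HasSize-× (HasSize-Fin n₁) (HasSize-× HasSize-Bool (HasSize-× (HasSize-Fin n₂) HasSize-Bool)))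

orbit-count-unequal : ∀ k a b f → 2 * (f * f) ≡ k * (2 * (1 * (a * (2 * (b * 2))))) → k * (4 * a * b) ≡ f ^ 2
orbit-count-unequal k a b f counted = *-cancelˡ-≡ _ _ 2 (begin
  2 * (k * (4 * a * b))               ≡⟨ regroup k a b ⟩
  k * (2 * (1 * (a * (2 * (b * 2))))) ≡⟨ sym counted ⟩
  2 * (f * f)                         ≡⟨ cong (λ x → 2 * (f * x)) (sym (*-identityʳ f)) ⟩
  2 * f ^ 2                           ∎)
  where
  regroup : ∀ k a b → 2 * (k * (4 * a * b)) ≡ k * (2 * (1 * (a * (2 * (b * 2)))))
  regroup = solve-∀

orbit-count-equal : ∀ k h n → 0 < n → h + h ≡ n →
  2 * (n ! * n !) ≡ k * (2 * (2 * (h * (2 * (h * 2))))) → k * 2 ≡ ((n ∸ 1) !) ^ 2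
orbit-count-equal k h (suc m) _ h+h≡n counted =
  *-cancelˡ-≡ _ _ 2 (*-cancelˡ-≡ _ _ (suc m) (*-cancelˡ-≡ _ _ (suc m) (begin
    suc m * (suc m * (2 * (k * 2)))      ≡⟨ cong (λ s → s * (s * (2 * (k * 2)))) (sym h+h≡n) ⟩
    (h + h) * ((h + h) * (2 * (k * 2)))  ≡⟨ regroupˡ k h ⟩
    k * (2 * (2 * (h * (2 * (h * 2)))))  ≡⟨ sym counted ⟩
    2 * (suc m ! * suc m !)              ≡⟨ regroupʳ (suc m) (m !) ⟩
    suc m * (suc m * (2 * (m !) ^ 2))    ∎)))
  where
  regroupˡ : ∀ k h → (h + h) * ((h + h) * (2 * (k * 2))) ≡ k * (2 * (2 * (h * (2 * (h * 2)))))
  regroupˡ = solve-∀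
  regroupʳ : ∀ s f → 2 * ((s * f) * (s * f)) ≡ s * (s * (2 * (f * (f * 1))))
  regroupʳ = solve-∀

positive-half : ∀ {h n} → h + h ≡ n → 0 < n → 0 < h
positive-half {suc _} _ _ = z<s
positive-half {zero} refl ()

module _ {n : ℕ} (σ : Permutation′ n) (derangement : Derangement σ) where

  cycles-of-unequal-length : ∀ {n₁ n₂} → TwoCycleProduct σ n₁ n₂ → 0 < n₂ → n₂ < n₁ →
    HasSize (Stabilizer (I ⊕ P σ)) (8 * n₁ * n₂) ×
    Σ ℕ (λ k → HasSize (Orbit (I ⊕ P σ)) k × k * (4 * n₁ * n₂) ≡ (n !) ^ 2)
  cycles-of-unequal-length {n₁} {n₂} cycles n₂>0 n₂<n₁ =
    let (k , orbit-size , counted) = orbit-stabilizer (I ⊕ P σ) stabilizer-size in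
    subst (HasSize _) (regroup n₁ n₂) stabilizer-size , k , orbit-size , orbit-count-unequal k n₁ n₂ (n !) counted
    where
    open TwoCycles σ derangement cycles (<-trans n₂>0 n₂<n₁) n₂>0
    stabilizer-size : HasSize (Stabilizer (I ⊕ P σ)) (2 * (1 * (n₁ * (2 * (n₂ * 2)))))
    stabilizer-size = Stabilizer-size (Swaps-size-≢ (>⇒≢ n₂<n₁))
    regroup : ∀ a b → 2 * (1 * (a * (2 * (b * 2)))) ≡ 8 * a * b
    regroup = solve-∀

  cycles-of-equal-length : ∀ {h} → TwoCycleProduct σ h h → h + h ≡ n → 0 < n →
    HasSize (Stabilizer (I ⊕ P σ)) (4 * n ^ 2) ×
    Σ ℕ (λ k → HasSize (Orbit (I ⊕ P σ)) k × k * 2 ≡ ((n ∸ 1) !) ^ 2)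
  cycles-of-equal-length {h} cycles h+h≡n n>0 =
    let (k , orbit-size , counted) = orbit-stabilizer (I ⊕ P σ) stabilizer-size in
    subst (HasSize _) (trans (regroup h) (cong (λ m → 4 * (m * (m * 1))) h+h≡n)) stabilizer-size ,
    k , orbit-size , orbit-count-equal k h n n>0 h+h≡n counted
    where
    h>0 : 0 < h
    h>0 = positive-half h+h≡n n>0
    open TwoCycles σ derangement cycles h>0 h>0
    stabilizer-size : HasSize (Stabilizer (I ⊕ P σ)) (2 * (2 * (h * (2 * (h * 2)))))
    stabilizer-size = Stabilizer-size (Swaps-size-≡ refl)
    regroup : ∀ h → 2 * (2 * (h * (2 * (h * 2)))) ≡ 4 * ((h + h) * ((h + h) * 1))
    regroup = solve-∀

corollary4p6 : (n n₁ n₂ : ℕ) (σ : Permutation′ n) →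
    Derangement σ → TwoCycleProduct σ n₁ n₂ → n₁ + n₂ ≡ n →
    (2 ≤ n₂ → n₂ < n₁ →
      HasSize (Stabilizer (I ⊕ P σ)) (8 * n₁ * n₂) ×
      Σ ℕ (λ k → HasSize (Orbit (I ⊕ P σ)) k × k * (4 * n₁ * n₂) ≡ (n !) ^ 2)) ×
    (4 < n → n₁ ≡ n₂ →
      HasSize (Stabilizer (I ⊕ P σ)) (4 * n ^ 2) ×
      Σ ℕ (λ k → HasSize (Orbit (I ⊕ P σ)) k × k * 2 ≡ ((n ∸ 1) !) ^ 2))
-- The bounds 2 ≤ n₂ and 4 < n are needed only to know that both cycles are nonempty.
corollary4p6 n n₁ n₂ σ derangement cycles n₁+n₂≡n =
  (λ 2≤n₂ n₂<n₁ → cycles-of-unequal-length σ derangement cycles (<-≤-trans z<s 2≤n₂) n₂<n₁) ,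
  (λ { 4<n refl → cycles-of-equal-length σ derangement cycles n₁+n₂≡n (<-trans z<s 4<n) })
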